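{- Let $\{H_n\}$ be the PLRS generated by $[c_1,\ldots,c_L]$, and for $n\ge1$ let $B_{H,n}=1+\sum_{i=1}^{n-1}H_i-H_n$. If $B_{H,n}\ge0$ for all $1\le n<L$ and $B_{H,n}>0$ for all $L\le n\le 2L-1$, then $\{H_n\}$ is complete.
   Context: A positive linear recurrence sequence (PLRS) generated by coefficients $[c_1,\ldots,c_L]$ (with $L\ge1$, $c_i$ nonnegative integers, $c_1>0$, $c_L>0$) is the sequence $\{H_n\}_{n\ge1}$ defined by $H_1=1$; for $1\le n<L$, $H_{n+1}=c_1H_n+c_2H_{n-1}+\cdots+c_nH_1+1$; and for $n\ge L$, $H_{n+1}=c_1H_n+\cdots+c_LH_{n+1-L}$. A sequence of positive integers is complete if every positive integer is a sum of distinct terms of the sequence. -}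

module Defs where

open import Data.Nat using (ℕ; zero; suc; _+_; _*_; _<_; _≤_; _<ᵇ_)
open import Data.List using (List; []; _∷_; zipWith; map; length; last)
open import Data.Nat.ListAction using (sum)
open import Data.List.Relation.Unary.All using (All)
open import Data.List.Relation.Unary.Unique.Propositional using (Unique)
open import Data.Maybe using (just)
open import Data.Bool using (if_then_else_)
open import Data.Integer using (ℤ; +_; _-_)
open import Data.Product using (Σ; _×_)
open import Relation.Binary.PropositionalEquality using (_≡_)

-- Coefficients [c₁, …, c_L] are given as a list cs with L = length cs.
-- history cs n = [H_n, H_{n-1}, …, H_1]  (1-based indexing of H).
-- H_{n+1} = Σ_{i=1}^{min(n,L)} c_i H_{n+1-i}  + (1 if n < L else 0),
-- which is exactly the PLRS definition (for n = 0 it gives H_1 = 1).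
history : List ℕ → ℕ → List ℕ
history cs zero = []
history cs (suc n) =
  (sum (zipWith _*_ cs (history cs n)) + (if n <ᵇ length cs then 1 else 0))
    ∷ history cs n

-- H cs n = H_n for n ≥ 1 (H cs 0 = 0 is an unused dummy value).
H : List ℕ → ℕ → ℕ
H cs zero = 0
H cs (suc n) = sum (zipWith _*_ cs (history cs n)) + (if n <ᵇ length cs then 1 else 0)

sumH : List ℕ → ℕ → ℕ
sumH cs zero = 0
sumH cs (suc k) = sumH cs k + H cs (suc k)

B : List ℕ → ℕ → ℤ
B cs zero = + 0
B cs (suc k) = (+ 1 Data.Integer.+ + sumH cs k) - + H cs (suc k)

ValidCoeffs : List ℕ → Set
ValidCoeffs [] = Data.Empty.⊥
  where import Data.Empty
ValidCoeffs (c₁ ∷ rest) = (0 < c₁) × Σ ℕ (λ cL → (last (c₁ ∷ rest) ≡ just cL) × (0 < cL))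

Complete : (ℕ → ℕ) → Set
Complete h = (m : ℕ) → 0 < m →
  Σ (List ℕ) (λ S → Unique S × All (λ i → 1 ≤ i) S × (sum (map h S) ≡ m))

{-# OPTIONS --safe #-}
-- A positive sequence h is complete as soon as h (n+1) ≤ 1 + h 1 + ⋯ + h n for every n
-- (Brown's criterion): greedily subtracting the largest admissible term represents every
-- m ≤ h 1 + ⋯ + h n. For n + 1 < L this bound is the hypothesis B ≥ 0. From index L on the
-- recurrence has no extra 1, and summing H (k+1) ≥ Σ c_i H (k+1-i) over k < n gives
-- Σ_{k ≤ n} H k ≥ Σ c_i Σ_{k < n+1-i} H k; hence H (n+1) ≤ Σ_{k ≤ n} H k once H j ≤ Σ_{k < j} H k
-- on the window of the L preceding indices. The hypothesis B > 0 on [L, 2L-1] supplies the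
-- first window, and induction then covers every index ≥ L.
module Submission where

open import Defs
open import Data.Nat using (ℕ; _<_; _≤_; _*_; _∸_)
open import Data.List using (List; length)
open import Data.Integer using (+_) renaming (_≤_ to _≤ℤ_; _<_ to _<ℤ_)

open import Data.Bool using (T; true; false; if_then_else_)
import Data.Integer as ℤ
import Data.Integer.Properties as ℤP
open import Data.List using ([]; _∷_; zipWith; map)
open import Data.List.Relation.Unary.All as All using (All; []; _∷_)
open import Data.List.Relation.Unary.AllPairs using ([]; _∷_)
open import Data.List.Relation.Unary.Unique.Propositional using (Unique)
open import Data.Nat using (zero; suc; _+_; _<ᵇ_; pred; z≤n; s≤s; _≤?_; _<?_)
open import Data.Nat.Induction using (<-rec)
open import Data.Nat.ListAction using (sum)
open import Data.Nat.Properties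
open import Data.Product using (Σ; _×_; _,_; proj₁)
open import Relation.Binary.PropositionalEquality
open import Relation.Nullary using (yes; no; contradiction)
open import Algebra.Properties.CommutativeSemigroup +-commutativeSemigroup
  using (interchange)

partialSum : (ℕ → ℕ) → ℕ → ℕ
partialSum h zero = 0
partialSum h (suc n) = partialSum h n + h (suc n)

sumBelow : (ℕ → ℕ) → ℕ → ℕ
sumBelow h j = partialSum h (pred j)

BrownBounded : (ℕ → ℕ) → Set
BrownBounded h = ∀ n → h (suc n) ≤ suc (partialSum h n)

DistinctSumUpTo : (ℕ → ℕ) → ℕ → ℕ → Set
DistinctSumUpTo h n m =
  Σ (List ℕ) λ S → Unique S × All (λ i → 1 ≤ i × i ≤ n) S × sum (map h S) ≡ m

module _ (h : ℕ → ℕ) where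

  private
    weakenBounds : ∀ {n S} → All (λ i → 1 ≤ i × i ≤ n) S → All (λ i → 1 ≤ i × i ≤ suc n) S
    weakenBounds = All.map λ (1≤i , i≤n) → 1≤i , m≤n⇒m≤1+n i≤n

  distinctSumUpTo-suc : ∀ {n m} → DistinctSumUpTo h n m → DistinctSumUpTo h (suc n) m
  distinctSumUpTo-suc (S , unique , bounds , S-sum) = S , unique , weakenBounds bounds , S-sum

  distinctSumUpTo-cons : ∀ {n m} → DistinctSumUpTo h n m →
                         DistinctSumUpTo h (suc n) (h (suc n) + m)
  distinctSumUpTo-cons {n} (S , unique , bounds , S-sum) =
    suc n ∷ S ,
    All.map (λ (_ , i≤n) → >⇒≢ (s≤s i≤n)) bounds ∷ unique ,
    (s≤s z≤n , ≤-refl) ∷ weakenBounds bounds ,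
    cong (_+_ (h (suc n))) S-sum

  ≤partialSum⇒distinctSum : BrownBounded h →
                            ∀ n m → m ≤ partialSum h n → DistinctSumUpTo h n m
  ≤partialSum⇒distinctSum bounded zero .zero z≤n = [] , [] , [] , refl
  ≤partialSum⇒distinctSum bounded (suc n) m m≤Sₙ₊₁ with m ≤? partialSum h n
  ... | yes m≤Sₙ = distinctSumUpTo-suc (≤partialSum⇒distinctSum bounded n m m≤Sₙ)
  ... | no m≰Sₙ = subst (DistinctSumUpTo h (suc n)) (m+[n∸m]≡n hₙ₊₁≤m)
        (distinctSumUpTo-cons (≤partialSum⇒distinctSum bounded n (m ∸ h (suc n)) rest≤Sₙ))
    where
    hₙ₊₁≤m : h (suc n) ≤ m
    hₙ₊₁≤m = ≤-trans (bounded n) (≰⇒> m≰Sₙ)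
    rest≤Sₙ : m ∸ h (suc n) ≤ partialSum h n
    rest≤Sₙ = ≤-trans (∸-monoˡ-≤ (h (suc n)) m≤Sₙ₊₁)
                      (≤-reflexive (m+n∸n≡m (partialSum h n) (h (suc n))))

  n≤partialSum : (∀ n → 1 ≤ h (suc n)) → ∀ n → n ≤ partialSum h n
  n≤partialSum positive zero = z≤n
  n≤partialSum positive (suc n) =
    subst (_≤ partialSum h (suc n)) (+-comm n 1)
      (+-mono-≤ (n≤partialSum positive n) (positive n))

  brownBounded⇒complete : (∀ n → 1 ≤ h (suc n)) → BrownBounded h → Complete h
  brownBounded⇒complete positive bounded m _
    with ≤partialSum⇒distinctSum bounded m m (n≤partialSum positive m)
  ... | S , unique , bounds , S-sum = S , unique , All.map proj₁ bounds , S-sum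

-- conv cs f n = Σ_{i = 1}^{min(L, n)} c_i f(n + 1 - i); f is only sampled at positive arguments.
conv : List ℕ → (ℕ → ℕ) → ℕ → ℕ
conv [] f n = 0
conv (c ∷ cs) f zero = 0
conv (c ∷ cs) f (suc n) = c * f (suc n) + conv cs f n

conv-zero : ∀ cs f → conv cs f 0 ≡ 0
conv-zero [] f = refl
conv-zero (c ∷ cs) f = refl

conv-mono : ∀ cs {f g} n → (∀ j → j ≤ n → n < j + length cs → f j ≤ g j) →
            conv cs f n ≤ conv cs g n
conv-mono [] n f≤g = z≤n
conv-mono (c ∷ cs) zero f≤g = z≤n
conv-mono (c ∷ cs) (suc n) f≤g =
  +-mono-≤ (*-monoʳ-≤ c (f≤g (suc n) ≤-refl (m<m+n (suc n) (s≤s z≤n))))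
           (conv-mono cs n λ j j≤n n<j+L → f≤g j (m≤n⇒m≤1+n j≤n)
              (subst (suc n <_) (sym (+-suc j (length cs))) (s≤s n<j+L)))

conv-sumBelow-suc : ∀ cs f n →
  conv cs (sumBelow f) (suc n) ≡ conv cs (sumBelow f) n + conv cs f n
conv-sumBelow-suc [] f n = refl
conv-sumBelow-suc (c ∷ cs) f zero
  rewrite *-zeroʳ c | conv-zero cs (sumBelow f) = refl
conv-sumBelow-suc (c ∷ cs) f (suc n) = begin
  c * (partialSum f n + f (suc n)) + conv cs (sumBelow f) (suc n)
    ≡⟨ cong₂ _+_ (*-distribˡ-+ c (partialSum f n) (f (suc n))) (conv-sumBelow-suc cs f n) ⟩
  (c * partialSum f n + c * f (suc n)) + (conv cs (sumBelow f) n + conv cs f n)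
    ≡⟨ interchange (c * partialSum f n) (c * f (suc n)) (conv cs (sumBelow f) n) (conv cs f n) ⟩
  (c * partialSum f n + conv cs (sumBelow f) n) + (c * f (suc n) + conv cs f n) ∎
  where open ≡-Reasoning

conv-sumBelow≤partialSum : ∀ cs f → (∀ n → conv cs f n ≤ f (suc n)) →
                           ∀ n → conv cs (sumBelow f) n ≤ partialSum f n
conv-sumBelow≤partialSum cs f dominates zero = ≤-reflexive (conv-zero cs (sumBelow f))
conv-sumBelow≤partialSum cs f dominates (suc n) = begin
  conv cs (sumBelow f) (suc n)               ≡⟨ conv-sumBelow-suc cs f n ⟩
  conv cs (sumBelow f) n + conv cs f n       ≤⟨ +-mono-≤ (conv-sumBelow≤partialSum cs f dominates n)
                                                         (dominates n) ⟩
  partialSum f n + f (suc n)                 ∎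
  where open ≤-Reasoning

window-induction : ∀ {p} (P : ℕ → Set p) L → 1 ≤ L →
  (∀ m → L ≤ m → m < L + L → P m) →
  (∀ n → L + L ≤ suc n → (∀ j → j ≤ n → n < j + L → P j) → P (suc n)) →
  ∀ m → L ≤ m → P m
window-induction P L 1≤L base step = <-rec (λ m → L ≤ m → P m) go
  where
  go : ∀ m → (∀ {k} → k < m → L ≤ k → P k) → L ≤ m → P m
  go zero _ L≤0 = contradiction L≤0 (<⇒≱ 1≤L)
  go (suc n) rec L≤n+1 with suc n <? L + L
  ... | yes n+1<2L = base (suc n) L≤n+1 n+1<2L
  ... | no n+1≮2L = step n 2L≤n+1 λ j j≤n n<j+L →
          rec (s≤s j≤n) (+-cancelʳ-≤ L L j (≤-trans 2L≤n+1 n<j+L))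
    where
    2L≤n+1 : L + L ≤ suc n
    2L≤n+1 = ≮⇒≥ n+1≮2L

sum-zipWith-history : ∀ cs ds n → sum (zipWith _*_ ds (history cs n)) ≡ conv ds (H cs) n
sum-zipWith-history cs [] n = refl
sum-zipWith-history cs (d ∷ ds) zero = refl
sum-zipWith-history cs (d ∷ ds) (suc n) =
  cong (_+_ (d * H cs (suc n))) (sum-zipWith-history cs ds n)

H-suc : ∀ cs n → H cs (suc n) ≡ conv cs (H cs) n + (if n <ᵇ length cs then 1 else 0)
H-suc cs n = cong (_+ (if n <ᵇ length cs then 1 else 0)) (sum-zipWith-history cs cs n)

≥⇒<ᵇ≡false : ∀ {m n} → n ≤ m → (m <ᵇ n) ≡ false
≥⇒<ᵇ≡false {m} {n} n≤m with m <ᵇ n in m<ᵇn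
... | false = refl
... | true = contradiction (<ᵇ⇒< m n (subst T (sym m<ᵇn) _)) (≤⇒≯ n≤m)

H-suc-linear : ∀ cs n → length cs ≤ n → H cs (suc n) ≡ conv cs (H cs) n
H-suc-linear cs n L≤n = begin
  H cs (suc n)                                              ≡⟨ H-suc cs n ⟩
  conv cs (H cs) n + (if n <ᵇ length cs then 1 else 0)      ≡⟨ cong (λ b → conv cs (H cs) n + (if b then 1 else 0))
                                                                    (≥⇒<ᵇ≡false L≤n) ⟩
  conv cs (H cs) n + 0                                      ≡⟨ +-identityʳ _ ⟩
  conv cs (H cs) n                                          ∎
  where open ≡-Reasoning

conv≤H-suc : ∀ cs n → conv cs (H cs) n ≤ H cs (suc n)
conv≤H-suc cs n = subst (conv cs (H cs) n ≤_) (sym (H-suc cs n)) (m≤m+n _ _)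

H-suc-pos : ∀ cs → ValidCoeffs cs → ∀ n → 1 ≤ H cs (suc n)
H-suc-pos (c ∷ cs) valid zero = ≤-refl
H-suc-pos (c ∷ cs) valid@(0<c , _) (suc n) = begin
  1                                          ≤⟨ *-mono-≤ 0<c (H-suc-pos (c ∷ cs) valid n) ⟩
  c * H (c ∷ cs) (suc n)                     ≤⟨ m≤m+n _ _ ⟩
  conv (c ∷ cs) (H (c ∷ cs)) (suc n)         ≤⟨ conv≤H-suc (c ∷ cs) (suc n) ⟩
  H (c ∷ cs) (suc (suc n))                   ∎
  where open ≤-Reasoning

H-suc≤partialSum : ∀ cs n → length cs ≤ n →
  (∀ j → j ≤ n → n < j + length cs → H cs j ≤ sumBelow (H cs) j) →
  H cs (suc n) ≤ partialSum (H cs) n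
H-suc≤partialSum cs n L≤n window = begin
  H cs (suc n)                  ≡⟨ H-suc-linear cs n L≤n ⟩
  conv cs (H cs) n              ≤⟨ conv-mono cs n window ⟩
  conv cs (sumBelow (H cs)) n   ≤⟨ conv-sumBelow≤partialSum cs (H cs) (conv≤H-suc cs) n ⟩
  partialSum (H cs) n           ∎
  where open ≤-Reasoning

sumH≡partialSum : ∀ cs n → sumH cs n ≡ partialSum (H cs) n
sumH≡partialSum cs zero = refl
sumH≡partialSum cs (suc n) = cong (_+ H cs (suc n)) (sumH≡partialSum cs n)

0≤m-n⇒n≤m : ∀ {m n} → + 0 ≤ℤ + m ℤ.- + n → n ≤ m
0≤m-n⇒n≤m {m} {n} 0≤m-n with ℤP.0≤i-j⇒j≤i {+ m} {+ n} 0≤m-n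
... | ℤ.+≤+ n≤m = n≤m

0<m-n⇒n<m : ∀ {m n} → + 0 <ℤ + m ℤ.- + n → n < m
0<m-n⇒n<m {m} {n} 0<m-n with n <? m
... | yes n<m = n<m
... | no n≮m = contradiction (ℤP.i≤j⇒i-j≤0 (ℤ.+≤+ (≮⇒≥ n≮m))) (ℤP.<⇒≱ 0<m-n)

B≥0⇒H≤1+sumBelow : ∀ cs n → + 0 ≤ℤ B cs n → H cs n ≤ suc (sumBelow (H cs) n)
B≥0⇒H≤1+sumBelow cs zero _ = z≤n
B≥0⇒H≤1+sumBelow cs (suc n) 0≤B =
  subst (λ s → H cs (suc n) ≤ suc s) (sumH≡partialSum cs n) (0≤m-n⇒n≤m 0≤B)

B>0⇒H≤sumBelow : ∀ cs n → + 0 <ℤ B cs n → H cs n ≤ sumBelow (H cs) n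
B>0⇒H≤sumBelow cs zero _ = z≤n
B>0⇒H≤sumBelow cs (suc n) 0<B =
  subst (H cs (suc n) ≤_) (sumH≡partialSum cs n) (≤-pred (0<m-n⇒n<m 0<B))

<⇒≤∸1 : ∀ {m n} → m < n → m ≤ n ∸ 1
<⇒≤∸1 (s≤s m≤n) = m≤n

mainTheorem12 : (cs : List ℕ) → ValidCoeffs cs →
    ((n : ℕ) → 1 ≤ n → n < length cs → + 0 ≤ℤ B cs n) →
    ((n : ℕ) → length cs ≤ n → n ≤ 2 * length cs ∸ 1 → + 0 <ℤ B cs n) →
    Complete (H cs)
mainTheorem12 cs@(_ ∷ _) valid B≥0 B>0 =
  brownBounded⇒complete (H cs) (H-suc-pos cs valid) brownBounded
  where
  L : ℕ
  L = length cs

  dominated : ∀ m → L ≤ m → H cs m ≤ sumBelow (H cs) m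
  dominated = window-induction (λ m → H cs m ≤ sumBelow (H cs) m) L (s≤s z≤n)
    (λ m L≤m m<2L → B>0⇒H≤sumBelow cs m (B>0 m L≤m
       (subst (λ k → m ≤ k ∸ 1) (cong (_+_ L) (sym (+-identityʳ L))) (<⇒≤∸1 m<2L))))
    (λ n 2L≤n+1 → H-suc≤partialSum cs n (≤-pred (≤-trans (m<m+n L (s≤s z≤n)) 2L≤n+1)))

  brownBounded : BrownBounded (H cs)
  brownBounded n with suc n <? L
  ... | yes n+1<L = B≥0⇒H≤1+sumBelow cs (suc n) (B≥0 (suc n) (s≤s z≤n) n+1<L)
  ... | no n+1≮L = m≤n⇒m≤1+n (dominated (suc n) (≮⇒≥ n+1≮L))
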